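{- Let $G$ be a directed graph viewed as the bipartite graph $(V_1,V_2,E)$ described below. Let $(S^*,T^*)$ be a directed densest subgraph, $D=\rho(S^*,T^*)$ and $z=\sqrt{|S^*|/|T^*|}$. Then any induced subgraph $H$ on nonempty vertex sets $(S,T)$, $S\subseteq V_1$, $T\subseteq V_2$, satisfying $d_H(v)\ge D/(2z)$ for all $v\in S$ and $d_H(v)\ge Dz/2$ for all $v\in T$ has density $\rho(S,T)\ge D/2$; that is, $(S,T)$ is a $2$-approximate directed densest subgraph.
   Context: A directed graph $G=(V,E_{\mathrm{dir}})$ is represented as a bipartite graph $(V_1,V_2,E)$ where $V_1,V_2$ are two copies of $V$ and $u\in V_1$, $v\in V_2$ are adjacent iff $(u,v)$ is a directed edge. For nonempty $S\subseteq V_1$, $T\subseteq V_2$, $E(S,T)$ denotes the edges between $S$ and $T$, and $\rho(S,T)=|E(S,T)|/\sqrt{|S||T|}$. A directed densest subgraph is a pair $(S^*,T^*)$ maximizing $\rho$. $d_H(v)$ is the degree of $v$ in the subgraph $H$ induced on $S\cup T$. -}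

module Defs where

open import Data.Nat using (ℕ; zero; suc; _+_; _*_; _≤_)
open import Data.Bool using (Bool; true; false; _∧_)
open import Data.Fin using (Fin; zero; suc)
open import Data.Fin.Subset using (Subset; ∣_∣; Nonempty; _∈_)
open import Data.Vec using (lookup)
open import Data.Product using (_×_)

Σ[_] : ∀ n → (Fin n → ℕ) → ℕ
Σ[ zero ] f = 0
Σ[ suc n ] f = f zero + Σ[ n ] (λ i → f (suc i))

ind : Bool → ℕ
ind true = 1
ind false = 0

-- A directed graph on vertex set Fin n, given by its adjacency relation
-- adj u v = true iff (u , v) is a directed edge.  Equivalently the bipartite
-- graph (V₁ , V₂ , E) with V₁ = V₂ = Fin n.
Digraph : ℕ → Set
Digraph n = Fin n → Fin n → Bool

edges : ∀ {n} → Digraph n → Subset n → Subset n → ℕ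
edges {n} G S T = Σ[ n ] λ u → Σ[ n ] λ v → ind (lookup S u ∧ lookup T v ∧ G u v)

degOut : ∀ {n} → Digraph n → Subset n → Fin n → ℕ
degOut {n} G T u = Σ[ n ] λ v → ind (lookup T v ∧ G u v)

degIn : ∀ {n} → Digraph n → Subset n → Fin n → ℕ
degIn {n} G S v = Σ[ n ] λ u → ind (lookup S u ∧ G u v)

-- ρ(S,T) ≤ ρ(S',T'), i.e. e/√(st) ≤ e'/√(s't'), stated in squared,
-- cross-multiplied form (all quantities are nonnegative, s,t,s',t' > 0):
--   e² · s' · t' ≤ e'² · s · t.
DensityLE : ∀ {n} → Digraph n → Subset n → Subset n → Subset n → Subset n → Set
DensityLE G S T S' T' =
  edges G S T * edges G S T * (∣ S' ∣ * ∣ T' ∣)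
    ≤ edges G S' T' * edges G S' T' * (∣ S ∣ * ∣ T ∣)

IsDensest : ∀ {n} → Digraph n → Subset n → Subset n → Set
IsDensest {n} G S* T* =
  Nonempty S* × Nonempty T* ×
  (∀ (S T : Subset n) → Nonempty S → Nonempty T → DensityLE G S T S* T*)

{-# OPTIONS --safe #-}
module Submission where

-- Summing the out-degrees d_H(u) over u ∈ S counts every edge of E(S,T)
-- exactly once, and so does summing the in-degrees over v ∈ T.  The degree
-- bounds therefore give |S| e*/(2|S*|) ≤ |E(S,T)| and |T| e*/(2|T*|) ≤ |E(S,T)|;
-- multiplying the two yields |S||T| e*² ≤ 4 |S*||T*| |E(S,T)|², which is
-- ρ(S,T) ≥ D/2.

open import Defs
open import Data.Nat using (ℕ; zero; suc; _*_; _+_; _≤_; z≤n)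
open import Data.Nat.Properties
  using (+-*-semiring; *-commutativeSemigroup; *-identityˡ; *-mono-≤; +-mono-≤; +-identityʳ; ≤-reflexive; ≤-trans)
open import Data.Bool using (Bool; true; false; _∧_)
open import Data.Fin using (Fin; zero; suc)
open import Data.Fin.Subset using (Subset; ∣_∣; Nonempty; _∈_)
open import Data.Vec using (_∷_; []; lookup; here; there)
open import Function using (_∘_)
open import Relation.Binary.PropositionalEquality
open import Algebra.Properties.Semiring.Sum +-*-semiring
  using (sum; sum-syntax; sum-cong-≗; ∑-comm; *-distribˡ-sum)
open import Algebra.Properties.CommutativeSemigroup *-commutativeSemigroup
  using (x∙yz≈y∙xz)
open import Data.Nat.Solver using (module +-*-Solver)

Σ≡sum : ∀ n (f : Fin n → ℕ) → Σ[ n ] f ≡ sum f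
Σ≡sum zero    f = refl
Σ≡sum (suc n) f = cong (f zero +_) (Σ≡sum n (f ∘ suc))

ind-∧ : ∀ (a b : Bool) → ind (a ∧ b) ≡ ind a * ind b
ind-∧ true  b = sym (*-identityˡ (ind b))
ind-∧ false b = refl

ind-∧-∧ : ∀ (a b c : Bool) → ind (a ∧ (b ∧ c)) ≡ ind b * ind (a ∧ c)
ind-∧-∧ true  true  c = sym (*-identityˡ (ind c))
ind-∧-∧ true  false c = refl
ind-∧-∧ false true  c = refl
ind-∧-∧ false false c = refl

module _ {n} (G : Digraph n) (S T : Subset n) where

  edges≡∑∑ : edges G S T ≡ ∑[ u < n ] ∑[ v < n ] ind (lookup S u ∧ lookup T v ∧ G u v)
  edges≡∑∑ = trans (Σ≡sum n _) (sum-cong-≗ {n} λ u → Σ≡sum n λ v → ind (lookup S u ∧ lookup T v ∧ G u v))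

  edges≡∑degOut : edges G S T ≡ ∑[ u < n ] (ind (lookup S u) * degOut G T u)
  edges≡∑degOut = begin
    edges G S T
      ≡⟨ edges≡∑∑ ⟩
    ∑[ u < n ] ∑[ v < n ] ind (lookup S u ∧ lookup T v ∧ G u v)
      ≡⟨ sum-cong-≗ {n} (λ u → sum-cong-≗ {n} λ v → ind-∧ (lookup S u) _) ⟩
    ∑[ u < n ] ∑[ v < n ] (ind (lookup S u) * ind (lookup T v ∧ G u v))
      ≡⟨ sum-cong-≗ {n} (λ u → sym (*-distribˡ-sum (ind (lookup S u)) λ v → ind (lookup T v ∧ G u v))) ⟩
    ∑[ u < n ] (ind (lookup S u) * ∑[ v < n ] ind (lookup T v ∧ G u v))
      ≡⟨ sum-cong-≗ {n} (λ u → cong (ind (lookup S u) *_) (sym (Σ≡sum n λ v → ind (lookup T v ∧ G u v)))) ⟩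
    ∑[ u < n ] (ind (lookup S u) * degOut G T u)
      ∎
    where open ≡-Reasoning

  edges≡∑degIn : edges G S T ≡ ∑[ v < n ] (ind (lookup T v) * degIn G S v)
  edges≡∑degIn = begin
    edges G S T
      ≡⟨ edges≡∑∑ ⟩
    ∑[ u < n ] ∑[ v < n ] ind (lookup S u ∧ lookup T v ∧ G u v)
      ≡⟨ sum-cong-≗ {n} (λ u → sum-cong-≗ {n} λ v → ind-∧-∧ (lookup S u) (lookup T v) (G u v)) ⟩
    ∑[ u < n ] ∑[ v < n ] (ind (lookup T v) * ind (lookup S u ∧ G u v))
      ≡⟨ ∑-comm {n} {n} _ ⟩
    ∑[ v < n ] ∑[ u < n ] (ind (lookup T v) * ind (lookup S u ∧ G u v))
      ≡⟨ sum-cong-≗ {n} (λ v → sym (*-distribˡ-sum (ind (lookup T v)) λ u → ind (lookup S u ∧ G u v))) ⟩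
    ∑[ v < n ] (ind (lookup T v) * ∑[ u < n ] ind (lookup S u ∧ G u v))
      ≡⟨ sum-cong-≗ {n} (λ v → cong (ind (lookup T v) *_) (sym (Σ≡sum n λ u → ind (lookup S u ∧ G u v)))) ⟩
    ∑[ v < n ] (ind (lookup T v) * degIn G S v)
      ∎
    where open ≡-Reasoning

∣S∣*a≤∑ : ∀ {n} (S : Subset n) (f : Fin n → ℕ) (a : ℕ) → (∀ u → u ∈ S → a ≤ f u) →
  ∣ S ∣ * a ≤ ∑[ u < n ] (ind (lookup S u) * f u)
∣S∣*a≤∑ []          f a a≤f = z≤n
∣S∣*a≤∑ (true ∷ S)  f a a≤f =
  +-mono-≤ (≤-trans (a≤f zero here) (≤-reflexive (sym (+-identityʳ (f zero)))))
           (∣S∣*a≤∑ S (f ∘ suc) a λ u u∈S → a≤f (suc u) (there u∈S))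
∣S∣*a≤∑ (false ∷ S) f a a≤f = ∣S∣*a≤∑ S (f ∘ suc) a λ u u∈S → a≤f (suc u) (there u∈S)

∣S∣*a≤c*∑ : ∀ {n} (S : Subset n) (f : Fin n → ℕ) (a c : ℕ) → (∀ u → u ∈ S → a ≤ c * f u) →
  ∣ S ∣ * a ≤ c * ∑[ u < n ] (ind (lookup S u) * f u)
∣S∣*a≤c*∑ {n} S f a c a≤cf = ≤-trans (∣S∣*a≤∑ S (λ u → c * f u) a a≤cf) (≤-reflexive (begin
  ∑[ u < n ] (ind (lookup S u) * (c * f u)) ≡⟨ sum-cong-≗ {n} (λ u → x∙yz≈y∙xz (ind (lookup S u)) c (f u)) ⟩
  ∑[ u < n ] (c * (ind (lookup S u) * f u)) ≡⟨ *-distribˡ-sum c (λ u → ind (lookup S u) * f u) ⟨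
  c * ∑[ u < n ] (ind (lookup S u) * f u)   ∎))
  where open ≡-Reasoning

module _ {n} (G : Digraph n) (S T : Subset n) (a c : ℕ) where

  ∣S∣*a≤c*edges : (∀ u → u ∈ S → a ≤ c * degOut G T u) → ∣ S ∣ * a ≤ c * edges G S T
  ∣S∣*a≤c*edges a≤c*deg =
    subst (λ e → ∣ S ∣ * a ≤ c * e) (sym (edges≡∑degOut G S T)) (∣S∣*a≤c*∑ S _ a c a≤c*deg)

  ∣T∣*a≤c*edges : (∀ v → v ∈ T → a ≤ c * degIn G S v) → ∣ T ∣ * a ≤ c * edges G S T
  ∣T∣*a≤c*edges a≤c*deg =
    subst (λ e → ∣ T ∣ * a ≤ c * e) (sym (edges≡∑degIn G S T)) (∣S∣*a≤c*∑ T _ a c a≤c*deg)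

mainTheorem4 : ∀ {n} (G : Digraph n) (S* T* : Subset n) → IsDensest G S* T* →
    ∀ (S T : Subset n) → Nonempty S → Nonempty T →
    (∀ u → u ∈ S → edges G S* T* ≤ 2 * ∣ S* ∣ * degOut G T u) →
    (∀ v → v ∈ T → edges G S* T* ≤ 2 * ∣ T* ∣ * degIn G S v) →
    edges G S* T* * edges G S* T* * (∣ S ∣ * ∣ T ∣)
      ≤ 4 * (edges G S T * edges G S T) * (∣ S* ∣ * ∣ T* ∣)
mainTheorem4 G S* T* _ S T _ _ degS degT =
  subst₂ _≤_ ([s*x]*[t*x]≡[x*x]*[s*t] ∣ S ∣ ∣ T ∣ e*) ([2s*x]*[2t*x]≡4[x*x]*[s*t] ∣ S* ∣ ∣ T* ∣ e)
    (*-mono-≤ (∣S∣*a≤c*edges G S T e* (2 * ∣ S* ∣) degS)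
              (∣T∣*a≤c*edges G S T e* (2 * ∣ T* ∣) degT))
  where
    open +-*-Solver
    e* e : ℕ
    e* = edges G S* T*
    e  = edges G S T
    [s*x]*[t*x]≡[x*x]*[s*t] : ∀ s t x → s * x * (t * x) ≡ x * x * (s * t)
    [s*x]*[t*x]≡[x*x]*[s*t] = solve 3 (λ s t x → s :* x :* (t :* x) := x :* x :* (s :* t)) refl
    [2s*x]*[2t*x]≡4[x*x]*[s*t] : ∀ s t x → 2 * s * x * (2 * t * x) ≡ 4 * (x * x) * (s * t)
    [2s*x]*[2t*x]≡4[x*x]*[s*t] = solve 3 (λ s t x → con 2 :* s :* x :* (con 2 :* t :* x) := con 4 :* (x :* x) :* (s :* t)) refl
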